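{- Let $T$ be the $k$-regular tree and $P$ the infinite path. For any $\varphi:V(T)\to\mathbb C$, the spherical mean $M_\varphi$ satisfies $$(\Delta_T M_\varphi)(x,r)=\big((\Delta_P+(2-k)\partial_r)M_\varphi\big)(x,r)\quad\text{for all }x\in V(T),\ r\in\mathbb Z_+,$$ where $\Delta_T$ acts in the variable $x$ and $\Delta_P$, $\partial_r$ act in the variable $r$.
   Context: $T$ is the infinite $k$-regular tree with graph distance $d$; $S(r)=|\{z:d(z,x)=r\}|$ ($=1$ for $r=0$, $k(k-1)^{r-1}$ for $r>0$). The spherical mean is $M_\varphi(x,r)=\frac{1}{S(r)}\sum_{d(z,x)=r}\varphi(z)$ for $r\ge 0$, extended evenly: $M_\varphi(x,-r)=M_\varphi(x,r)$. $P$ is the path with vertex set $\mathbb Z$ and edges $\{r,r+1\}$. For a graph, $\Delta f(x)=m(x)f(x)-\sum_{y\sim x}f(y)$ with $m(x)$ the degree; thus $\Delta_T F(x)=kF(x)-\sum_{y\sim x}F(y)$ and $\Delta_P v(r)=2v(r)-v(r+1)-v(r-1)$. $\partial_r v(r)=v(r+1)-v(r)$ for $r\in\mathbb Z$. -}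

module Defs where

open import Level using (Level)
open import Data.Nat as ℕ using (ℕ; zero; suc; _∸_; _^_)
open import Data.Integer as ℤ using (ℤ; ∣_∣)
open import Data.Fin using (Fin) renaming (_≟_ to _≟ᶠ_)
open import Data.List using (List; []; _∷_; [_]; _++_; reverse; foldr; map; length; concatMap; filter; upTo)
open import Data.List.Base using (allFin)
open import Data.Bool using (Bool; true; false; T; _∧_; not; if_then_else_)
open import Data.Bool.Properties using (T?)
open import Data.Product using (Σ; _,_; proj₁)
open import Relation.Nullary using (does; yes; no)
open import Algebra.Bundles using (CommutativeRing)

-- The k-regular tree T, realised as the Cayley graph of the free product
-- of k copies of Z/2 (generators a ∈ Fin k, each an involution).

noBacktrack : ∀ {k} → List (Fin k) → Bool
noBacktrack []           = true
noBacktrack (a ∷ [])     = true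
noBacktrack (a ∷ b ∷ w)  = not (does (a ≟ᶠ b)) ∧ noBacktrack (b ∷ w)

Vertex : ℕ → Set
Vertex k = Σ (List (Fin k)) (λ w → T (noBacktrack w))

-- free reduction (cancel adjacent equal letters, since a·a = 1)
push : ∀ {k} → Fin k → List (Fin k) → List (Fin k)
push a []      = a ∷ []
push a (b ∷ w) = if does (a ≟ᶠ b) then w else (a ∷ b ∷ w)

reduce : ∀ {k} → List (Fin k) → List (Fin k)
reduce = foldr push []

-- graph distance d(x,y) = length of the reduced word x⁻¹y
-- (x⁻¹ = reverse x since each generator is an involution)
dist : ∀ {k} → Vertex k → Vertex k → ℕ
dist (x , _) (y , _) = length (reduce (reverse x ++ y))

wordsOfLength : ∀ k → ℕ → List (List (Fin k))
wordsOfLength k zero    = [] ∷ []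
wordsOfLength k (suc n) = concatMap (λ w → map (λ a → a ∷ w) (allFin k)) (wordsOfLength k n)

toVertex : ∀ {k} → List (Fin k) → List (Vertex k)
toVertex w with T? (noBacktrack w)
... | yes p = [ (w , p) ]
... | no _  = []

ballAtRoot : ∀ k → ℕ → List (Vertex k)
ballAtRoot k n = concatMap toVertex (concatMap (wordsOfLength k) (upTo (suc n)))

-- the sphere {z : d(z,x) = r}, enumerated without repetition
-- (every such z has word length ≤ |x| + r)
sphere : ∀ {k} → Vertex k → ℕ → List (Vertex k)
sphere {k} x r = filter (λ z → dist z x ℕ.≟ r) (ballAtRoot k (length (proj₁ x) ℕ.+ r))

S : ℕ → ℕ → ℕ
S k zero    = 1
S k (suc r) = k ℕ.* ((k ∸ 1) ^ r)

-- Operators with values in a commutative ring R, given a function inv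
-- (intended: inv n = n⁻¹ for n ≥ 1, i.e. R is a Q-algebra such as ℂ).

module Ops {c ℓ : Level} (R : CommutativeRing c ℓ) (inv : ℕ → CommutativeRing.Carrier R) where
  open CommutativeRing R

  ι : ℕ → Carrier
  ι zero    = 0#
  ι (suc n) = 1# + ι n

  sumR : List Carrier → Carrier
  sumR = foldr _+_ 0#

  -- spherical mean, extended evenly to r ∈ ℤ
  M : ∀ {k} → (Vertex k → Carrier) → Vertex k → ℤ → Carrier
  M {k} φ x r = inv (S k ∣ r ∣) * sumR (map φ (sphere x ∣ r ∣))

  ΔT : ∀ {k} → (Vertex k → Carrier) → Vertex k → Carrier
  ΔT {k} F x = ι k * F x - sumR (map F (sphere x 1))

  ΔP : (ℤ → Carrier) → ℤ → Carrier
  ΔP v r = (ι 2 * v r - v (r ℤ.+ ℤ.+ 1)) - v (r ℤ.- ℤ.+ 1)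

  ∂r : (ℤ → Carrier) → ℤ → Carrier
  ∂r v r = v (r ℤ.+ ℤ.+ 1) - v r

module Submission where

-- The tree is the Cayley graph of the free product of k copies of Z/2, i.e. the
-- group of reduced words.  Left translation by x is a graph automorphism, so the
-- sphere of radius r about x is the translate x · L_r of the layer L_r of reduced
-- words of length r.  The neighbours of x are x·a for the k letters a, hence
--   Σ_{y∼x} Σ_{d(z,y)=r} φ(z) = Σ_{w ∈ L_r} Σ_a φ(x·a·w).
-- For w = b u of length r ≥ 1 the words a·w are the parent u (a = b) and the
-- k - 1 children a w; counting multiplicities layer by layer gives
--   Σ_{y∼x} A(y, 0) = A(x, 1),   Σ_{y∼x} A(y, r+1) = A(x, r+2) + c_r A(x, r)
-- for the sphere totals A, where c_0 = k and c_r = k - 1 otherwise.  Since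
-- S(r+1) = c_r S(r), dividing by S(r) yields Σ_{y∼x} M(y, r) = (k-1) M(x, r+1)
-- + M(x, r-1) (using M(x, -1) = M(x, 1)), and the theorem is a ring identity.

open import Defs
open import Data.Nat using (ℕ; suc; _≤_)
open import Data.Integer using (+_)
open import Algebra.Bundles using (CommutativeRing)

open import Data.Nat as ℕ using (zero; z≤n; s≤s; _∸_; _^_; NonZero)
import Data.Nat.Properties as ℕP
import Data.Integer as ℤ
open import Data.Fin using (Fin) renaming (_≟_ to _≟ᶠ_; zero to fzero; suc to fsuc)
open import Data.List using (List; []; _∷_; [_]; _++_; reverse; reverseAcc; foldr; map; length;
  concatMap; allFin)
import Data.List.Properties as LP
open import Data.List.Membership.Propositional using (_∈_; find; lose)
open import Data.List.Membership.Propositional.Properties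
  using (∈-concatMap⁺; ∈-concatMap⁻; ∈-allFin; ∈-upTo⁺; ∈-filter⁺; ∈-filter⁻; ∈-map⁺; ∈-map⁻)
open import Data.List.Membership.Propositional.Properties.WithK using (unique∧set⇒bag)
open import Data.List.Relation.Unary.Any using (here; there)
import Data.List.Relation.Unary.All as All
open import Data.List.Relation.Unary.AllPairs using ([]; _∷_)
open import Data.List.Relation.Unary.Unique.Propositional using (Unique)
import Data.List.Relation.Unary.Unique.Propositional.Properties as Unique
open import Data.List.Relation.Binary.Permutation.Propositional using (_↭_; ↭⇒↭ₛ′)
import Data.List.Relation.Binary.Permutation.Propositional.Properties as Perm
import Data.List.Relation.Binary.Permutation.Setoid.Properties as PermSetoid
open import Data.List.Relation.Binary.BagAndSetEquality using (∼bag⇒↭)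
open import Data.Bool using (true; false; T; not; _∧_; if_then_else_)
open import Data.Bool.Properties using (T?; T-irrelevant)
open import Data.Unit using (⊤; tt)
open import Data.Empty using (⊥; ⊥-elim)
open import Data.Product using (∃; _,_; proj₁; proj₂; _×_)
open import Function.Base using (_∘_)
open import Function.Bundles using (mk⇔)
open import Relation.Nullary using (Dec; does; yes; no; ¬_)
open import Relation.Binary.PropositionalEquality as ≡ using (_≡_; module ≡-Reasoning)

concatMap-unique : ∀ {A B : Set} (f : A → List B) {xs : List A} → Unique xs →
  (∀ x → Unique (f x)) → (∀ {x y b} → b ∈ f x → b ∈ f y → x ≡ y) →
  Unique (concatMap f xs)
concatMap-unique f {[]}     _          _        _        = []
concatMap-unique f {x ∷ xs} (x∉xs ∷ u) f-unique disjoint =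
  Unique.++⁺ (f-unique x) (concatMap-unique f u f-unique disjoint) separated
  where
  separated : ∀ {b} → b ∈ f x × b ∈ concatMap f xs → ⊥
  separated (b∈fx , b∈rest) with find (∈-concatMap⁻ f b∈rest)
  ... | y , y∈xs , b∈fy = All.lookup x∉xs y∈xs (disjoint b∈fx b∈fy)

↭-fromMembers : ∀ {A : Set} {xs ys : List A} → Unique xs → Unique ys →
  (∀ {z} → z ∈ xs → z ∈ ys) → (∀ {z} → z ∈ ys → z ∈ xs) → xs ↭ ys
↭-fromMembers ux uy to from = ∼bag⇒↭ (unique∧set⇒bag ux uy (mk⇔ to from))

module ReducedWords {k : ℕ} where
  open ≡ using (refl; sym; trans; cong; subst₂)

  Word : Set
  Word = List (Fin k)

  -- A wrapper around 'T (noBacktrack w)' that keeps the word visible to unification.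
  record Reduced (w : Word) : Set where
    constructor mkReduced
    field reduced : T (noBacktrack w)
  open Reduced public

  tail-reduced : ∀ {a : Fin k} {w} → Reduced (a ∷ w) → Reduced w
  tail-reduced {a} {[]}    _               = mkReduced tt
  tail-reduced {a} {b ∷ w} (mkReduced p) with a ≟ᶠ b
  ... | yes _ = ⊥-elim p
  ... | no _  = mkReduced p

  head-distinct : ∀ {a b : Fin k} {w} → Reduced (a ∷ b ∷ w) → ¬ a ≡ b
  head-distinct {a} {b} (mkReduced p) with a ≟ᶠ b
  ... | yes _  = ⊥-elim p
  ... | no a≢b = a≢b

  cons-reduced : ∀ {a b : Fin k} {w} → ¬ a ≡ b → Reduced (b ∷ w) → Reduced (a ∷ b ∷ w)
  cons-reduced {a} {b} {w} a≢b (mkReduced p) = mkReduced (link (a ≟ᶠ b))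
    where
    link : (d : Dec (a ≡ b)) → T (not (does d) ∧ noBacktrack (b ∷ w))
    link (yes a≡b) = ⊥-elim (a≢b a≡b)
    link (no _)    = p

  push-self : ∀ (a : Fin k) w → push a (a ∷ w) ≡ w
  push-self a w with a ≟ᶠ a
  ... | yes _   = refl
  ... | no a≢a = ⊥-elim (a≢a refl)

  push-other : ∀ {a b : Fin k} w → ¬ a ≡ b → push a (b ∷ w) ≡ a ∷ b ∷ w
  push-other {a} {b} w a≢b with a ≟ᶠ b
  ... | yes a≡b = ⊥-elim (a≢b a≡b)
  ... | no _    = refl

  push-reduced : ∀ (a : Fin k) {w} → Reduced w → Reduced (push a w)
  push-reduced a {[]}    _ = mkReduced tt
  push-reduced a {b ∷ w} r with a ≟ᶠ b
  ... | yes _  = tail-reduced r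
  ... | no a≢b = cons-reduced a≢b r

  push-involutive : ∀ (a : Fin k) {w} → Reduced w → push a (push a w) ≡ w
  push-involutive a {[]} _ = push-self a []
  push-involutive a {b ∷ w} r with a ≟ᶠ b
  push-involutive a {b ∷ w}     r | no _     = push-self a (b ∷ w)
  push-involutive a {b ∷ []}    r | yes refl = refl
  push-involutive a {b ∷ c ∷ w} r | yes refl = push-other w (head-distinct r)

  _·_ : Word → Word → Word
  u · w = foldr push w u

  ·-reduced : ∀ (u : Word) {w} → Reduced w → Reduced (u · w)
  ·-reduced []      r = r
  ·-reduced (a ∷ u) r = push-reduced a (·-reduced u r)

  ·-++ : ∀ (u v w : Word) → (u ++ v) · w ≡ u · (v · w)
  ·-++ u v w = LP.foldr-++ push w u v

  reduce-reduced : ∀ (u : Word) → Reduced (reduce u)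
  reduce-reduced u = ·-reduced u (mkReduced tt)

  reduce-id : ∀ {w : Word} → Reduced w → reduce w ≡ w
  reduce-id {[]}        _ = refl
  reduce-id {a ∷ []}    _ = refl
  reduce-id {a ∷ b ∷ w} r =
    trans (cong (push a) (reduce-id (tail-reduced r))) (push-other w (head-distinct r))

  ·-reduce : ∀ (u : Word) {w} → Reduced w → u · w ≡ reduce u · w
  ·-reduce []      _ = refl
  ·-reduce (a ∷ u) {w} r = trans (cong (push a) (·-reduce u r)) (push-· (reduce u) (reduce-reduced u))
    where
    push-· : ∀ (v : Word) → Reduced v → push a (v · w) ≡ push a v · w
    push-· []      _ = refl
    push-· (b ∷ v) s with a ≟ᶠ b
    ... | yes refl = push-involutive a (·-reduced v r)
    ... | no _     = refl

  ·-as-reduce : ∀ (u : Word) {w} → Reduced w → u · w ≡ reduce (u ++ w)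
  ·-as-reduce u {w} r = trans (cong (u ·_) (sym (reduce-id r))) (sym (·-++ u w []))

  reverse-cancel : ∀ (u : Word) {w} → Reduced w → (reverse u ++ u) · w ≡ w
  reverse-cancel []      r = refl
  reverse-cancel (a ∷ u) {w} r = begin
      (reverse (a ∷ u) ++ a ∷ u) · w      ≡⟨ cong (λ v → (v ++ a ∷ u) · w) (LP.unfold-reverse a u) ⟩
      ((reverse u ++ [ a ]) ++ a ∷ u) · w  ≡⟨ cong (_· w) (LP.++-assoc (reverse u) [ a ] (a ∷ u)) ⟩
      (reverse u ++ a ∷ a ∷ u) · w         ≡⟨ ·-++ (reverse u) (a ∷ a ∷ u) w ⟩
      reverse u · push a (push a (u · w))  ≡⟨ cong (reverse u ·_) (push-involutive a (·-reduced u r)) ⟩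
      reverse u · (u · w)                  ≡⟨ sym (·-++ (reverse u) u w) ⟩
      (reverse u ++ u) · w                 ≡⟨ reverse-cancel u r ⟩
      w                                    ∎
    where open ≡-Reasoning

  ·-inverseˡ : ∀ (u : Word) {w} → Reduced w → reverse u · (u · w) ≡ w
  ·-inverseˡ u {w} r = trans (sym (·-++ (reverse u) u w)) (reverse-cancel u r)

  ·-inverseʳ : ∀ (u : Word) {w} → Reduced w → u · (reverse u · w) ≡ w
  ·-inverseʳ u {w} r = begin
    u · (reverse u · w)                    ≡⟨ cong (_· (reverse u · w)) (sym (LP.reverse-involutive u)) ⟩
    reverse (reverse u) · (reverse u · w)  ≡⟨ ·-inverseˡ (reverse u) r ⟩
    w                                      ∎
    where open ≡-Reasoning

  reverse-reduced : ∀ {w : Word} → Reduced w → Reduced (reverse w)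
  reverse-reduced {w} r = go w [] r (mkReduced tt) (junction-nil w)
    where
    Junction : Word → Word → Set
    Junction (a ∷ _) (b ∷ _) = ¬ a ≡ b
    Junction _       _       = ⊤

    junction-nil : ∀ v → Junction v []
    junction-nil []      = tt
    junction-nil (_ ∷ _) = tt

    go : ∀ v acc → Reduced v → Reduced acc → Junction v acc → Reduced (reverseAcc acc v)
    go []      acc _ s _ = s
    go (a ∷ v) acc r s j = go v (a ∷ acc) (tail-reduced r) (glue acc s j) (junction v r)
      where
      glue : ∀ acc → Reduced acc → Junction (a ∷ v) acc → Reduced (a ∷ acc)
      glue []      _ _ = mkReduced tt
      glue (b ∷ _) s j = cons-reduced j s
      junction : ∀ v → Reduced (a ∷ v) → Junction v (a ∷ acc)
      junction []      _ = tt
      junction (b ∷ v) r b≡a = head-distinct r (sym b≡a)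

  reverse-reduce : ∀ (w : Word) → reverse (reduce w) ≡ reduce (reverse w)
  reverse-reduce w = begin
      reverse v                  ≡⟨ cong reverse v≡s⁻¹ ⟩
      reverse (reverse s)        ≡⟨ LP.reverse-involutive s ⟩
      s                          ∎
    where
    open ≡-Reasoning
    s = reduce (reverse w)
    v = reduce w
    s·v≡ε : s · v ≡ []
    s·v≡ε = begin
      s · v                     ≡⟨ sym (·-reduce (reverse w) (reduce-reduced w)) ⟩
      reverse w · (w · [])      ≡⟨ ·-inverseˡ w (mkReduced tt) ⟩
      []                        ∎
    v≡s⁻¹ : v ≡ reverse s
    v≡s⁻¹ = begin
      v                         ≡⟨ sym (·-inverseˡ s (reduce-reduced w)) ⟩
      reverse s · (s · v)       ≡⟨ cong (reverse s ·_) s·v≡ε ⟩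
      reduce (reverse s)        ≡⟨ reduce-id (reverse-reduced (reduce-reduced (reverse w))) ⟩
      reverse s                 ∎

  -- |u · w| ≤ |u| + |w|, since each letter changes the length by at most one.
  length-· : ∀ (u w : Word) → length (u · w) ℕ.≤ length u ℕ.+ length w
  length-· []      w = ℕP.≤-refl
  length-· (a ∷ u) w = ℕP.≤-trans (length-push (u · w)) (s≤s (length-· u w))
    where
    length-push : ∀ v → length (push a v) ℕ.≤ suc (length v)
    length-push []      = ℕP.≤-refl
    length-push (b ∷ v) with does (a ≟ᶠ b)
    ... | true  = ℕP.≤-trans (ℕP.n≤1+n _) (ℕP.n≤1+n _)
    ... | false = ℕP.≤-refl

  V : Set
  V = Vertex k

  root : V
  root = [] , tt

  word-reduced : (z : V) → Reduced (proj₁ z)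
  word-reduced z = mkReduced (proj₂ z)

  vertex-≡ : {z z′ : V} → proj₁ z ≡ proj₁ z′ → z ≡ z′
  vertex-≡ {w , p} {.w , q} refl = cong (w ,_) (T-irrelevant p q)

  size : V → ℕ
  size z = length (proj₁ z)

  infixl 7 _⋆_
  infix 8 _⁻¹

  _⋆_ : V → V → V
  x ⋆ w = proj₁ x · proj₁ w , reduced (·-reduced (proj₁ x) (word-reduced w))

  _⁻¹ : V → V
  x ⁻¹ = reverse (proj₁ x) , reduced (reverse-reduced (word-reduced x))

  ⋆-inverseˡ : ∀ x w → x ⁻¹ ⋆ (x ⋆ w) ≡ w
  ⋆-inverseˡ x w = vertex-≡ (·-inverseˡ (proj₁ x) (word-reduced w))

  ⋆-inverseʳ : ∀ x z → x ⋆ (x ⁻¹ ⋆ z) ≡ z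
  ⋆-inverseʳ x z = vertex-≡ (·-inverseʳ (proj₁ x) (word-reduced z))

  ⋆-cancelˡ : ∀ x {w w′} → x ⋆ w ≡ x ⋆ w′ → w ≡ w′
  ⋆-cancelˡ x {w} {w′} eq = begin
    w                 ≡⟨ sym (⋆-inverseˡ x w) ⟩
    x ⁻¹ ⋆ (x ⋆ w)    ≡⟨ cong (x ⁻¹ ⋆_) eq ⟩
    x ⁻¹ ⋆ (x ⋆ w′)   ≡⟨ ⋆-inverseˡ x w′ ⟩
    w′                ∎
    where open ≡-Reasoning

  ⋆-assoc : ∀ x v w → (x ⋆ v) ⋆ w ≡ x ⋆ (v ⋆ w)
  ⋆-assoc (x , _) v (w , q) = vertex-≡ (begin
    (x · proj₁ v) · w      ≡⟨ cong (_· w) (·-as-reduce x (word-reduced v)) ⟩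
    reduce (x ++ proj₁ v) · w ≡⟨ sym (·-reduce (x ++ proj₁ v) (mkReduced q)) ⟩
    (x ++ proj₁ v) · w     ≡⟨ ·-++ x (proj₁ v) w ⟩
    x · (proj₁ v · w)      ∎)
    where open ≡-Reasoning

  dist-as-size : ∀ z x → size (x ⁻¹ ⋆ z) ≡ dist z x
  dist-as-size (z , p) (x , _) = begin
    length (reverse x · z)                           ≡⟨ cong length (·-as-reduce (reverse x) (mkReduced p)) ⟩
    length (reduce (reverse x ++ z))                 ≡⟨ sym (LP.length-reverse (reduce (reverse x ++ z))) ⟩
    length (reverse (reduce (reverse x ++ z)))       ≡⟨ cong length (reverse-reduce (reverse x ++ z)) ⟩
    length (reduce (reverse (reverse x ++ z)))       ≡⟨ cong (length ∘ reduce) (LP.reverse-++ (reverse x) z) ⟩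
    length (reduce (reverse z ++ reverse (reverse x))) ≡⟨ cong (λ v → length (reduce (reverse z ++ v))) (LP.reverse-involutive x) ⟩
    length (reduce (reverse z ++ x))                 ∎
    where open ≡-Reasoning

  dist-translate : ∀ x w → dist (x ⋆ w) x ≡ size w
  dist-translate x w = trans (sym (dist-as-size (x ⋆ w) x)) (cong size (⋆-inverseˡ x w))

  -- |z| ≤ |x| + d(z, x), since z = x · (x⁻¹ z).
  size-≤-dist : ∀ z x → size z ℕ.≤ size x ℕ.+ dist z x
  size-≤-dist z x = subst₂ (λ v d → size v ℕ.≤ size x ℕ.+ d) (⋆-inverseʳ x z) (dist-as-size z x)
    (length-· (proj₁ x) (proj₁ (x ⁻¹ ⋆ z)))

module Spheres {k : ℕ} where
  open ReducedWords {k}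
  open ≡ using (refl; sym; trans; cong; subst)

  toVertex-sound : ∀ {w : Word} {z} → z ∈ toVertex w → proj₁ z ≡ w
  toVertex-sound {w} z∈ with T? (noBacktrack w)
  toVertex-sound (here refl) | yes _ = refl
  toVertex-sound ()          | no _

  toVertex-complete : ∀ {w : Word} (p : T (noBacktrack w)) → (w , p) ∈ toVertex w
  toVertex-complete {w} p with T? (noBacktrack w)
  ... | yes q = here (cong (w ,_) (T-irrelevant p q))
  ... | no ¬p = ⊥-elim (¬p p)

  toVertex-unique : ∀ (w : Word) → Unique (toVertex w)
  toVertex-unique w with T? (noBacktrack w)
  ... | yes _ = All.[] ∷ []
  ... | no _  = []

  toVertex-injective : ∀ {w w′ : Word} {z} → z ∈ toVertex w → z ∈ toVertex w′ → w ≡ w′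
  toVertex-injective z∈w z∈w′ = trans (sym (toVertex-sound z∈w)) (toVertex-sound z∈w′)

  toVertex-empty : ∀ {w : Word} → ¬ T (noBacktrack w) → toVertex w ≡ []
  toVertex-empty {w} ¬p with T? (noBacktrack w)
  ... | yes p = ⊥-elim (¬p p)
  ... | no _  = refl

  toVertex-single : ∀ {w : Word} (p : T (noBacktrack w)) → toVertex w ≡ [ (w , p) ]
  toVertex-single {w} p with T? (noBacktrack w)
  ... | yes q = cong (λ q → [ (w , q) ]) (T-irrelevant q p)
  ... | no ¬p = ⊥-elim (¬p p)

  children : V → List V
  children v = concatMap (λ a → toVertex (a ∷ proj₁ v)) (allFin k)

  layer : ℕ → List V
  layer zero    = [ root ]
  layer (suc r) = concatMap children (layer r)

  children-sound : ∀ {v z} → z ∈ children v → ∃ λ a → proj₁ z ≡ a ∷ proj₁ v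
  children-sound {v} z∈ with find (∈-concatMap⁻ (λ a → toVertex (a ∷ proj₁ v)) {xs = allFin k} z∈)
  ... | a , _ , z∈a = a , toVertex-sound z∈a

  children-unique : ∀ v → Unique (children v)
  children-unique v = concatMap-unique (λ a → toVertex (a ∷ proj₁ v)) (Unique.allFin⁺ k)
    (λ a → toVertex-unique (a ∷ proj₁ v)) (λ z∈a z∈b → LP.∷-injectiveˡ (toVertex-injective z∈a z∈b))

  layer-sound : ∀ r {z} → z ∈ layer r → size z ≡ r
  layer-sound zero    (here refl) = refl
  layer-sound (suc r) z∈ with find (∈-concatMap⁻ children z∈)
  ... | v , v∈ , z∈v with children-sound {v} z∈v
  ... | a , z≡av = trans (cong length z≡av) (cong suc (layer-sound r v∈))

  layer-complete : ∀ z → z ∈ layer (size z)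
  layer-complete (w , p) = go w p
    where
    go : ∀ (w : Word) (p : T (noBacktrack w)) → (w , p) ∈ layer (length w)
    go []      tt = here refl
    go (a ∷ w) p  = ∈-concatMap⁺ children (lose (go w q) (∈-concatMap⁺ (λ b → toVertex (b ∷ w))
                      (lose (∈-allFin a) (toVertex-complete p))))
      where
      q : T (noBacktrack w)
      q = reduced (tail-reduced {a} {w} (mkReduced p))

  layer-unique : ∀ r → Unique (layer r)
  layer-unique zero    = All.[] ∷ []
  layer-unique (suc r) = concatMap-unique children (layer-unique r) children-unique parent-unique
    where
    parent-unique : ∀ {v v′ z} → z ∈ children v → z ∈ children v′ → v ≡ v′
    parent-unique {v} {v′} z∈v z∈v′ =
      vertex-≡ (LP.∷-injectiveʳ (trans (sym (proj₂ (children-sound {v} z∈v))) (proj₂ (children-sound {v′} z∈v′))))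

  words-sound : ∀ n {w : Word} → w ∈ wordsOfLength k n → length w ≡ n
  words-sound zero    (here refl) = refl
  words-sound (suc n) w∈ with find (∈-concatMap⁻ (λ u → map (_∷ u) (allFin k)) w∈)
  ... | u , u∈ , w∈u with ∈-map⁻ (_∷ u) w∈u
  ... | a , _ , w≡au = trans (cong length w≡au) (cong suc (words-sound n u∈))

  words-complete : ∀ (w : Word) → w ∈ wordsOfLength k (length w)
  words-complete []      = here refl
  words-complete (a ∷ w) = ∈-concatMap⁺ (λ u → map (_∷ u) (allFin k))
    (lose (words-complete w) (∈-map⁺ (_∷ w) (∈-allFin a)))

  words-unique : ∀ n → Unique (wordsOfLength k n)
  words-unique zero    = All.[] ∷ []
  words-unique (suc n) = concatMap-unique (λ u → map (_∷ u) (allFin k)) (words-unique n)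
    (λ _ → Unique.map⁺ LP.∷-injectiveˡ (Unique.allFin⁺ k)) same-tail
    where
    same-tail : ∀ {u u′ w} → w ∈ map (_∷ u) (allFin k) → w ∈ map (_∷ u′) (allFin k) → u ≡ u′
    same-tail {u} {u′} w∈u w∈u′ with ∈-map⁻ (_∷ u) w∈u | ∈-map⁻ (_∷ u′) w∈u′
    ... | _ , _ , w≡au | _ , _ , w≡bu′ = LP.∷-injectiveʳ (trans (sym w≡au) w≡bu′)

  ball-unique : ∀ n → Unique (ballAtRoot k n)
  ball-unique n = concatMap-unique toVertex
    (concatMap-unique (wordsOfLength k) (Unique.upTo⁺ (suc n)) words-unique
      (λ {i} {j} w∈i w∈j → trans (sym (words-sound i w∈i)) (words-sound j w∈j)))
    toVertex-unique toVertex-injective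

  ball-complete : ∀ n z → size z ℕ.≤ n → z ∈ ballAtRoot k n
  ball-complete n (w , p) |w|≤n = ∈-concatMap⁺ toVertex
    (lose (∈-concatMap⁺ (wordsOfLength k) (lose (∈-upTo⁺ (s≤s |w|≤n)) (words-complete w))) (toVertex-complete p))

  sphere-unique : ∀ x r → Unique (sphere x r)
  sphere-unique x r = Unique.filter⁺ (λ z → dist z x ℕ.≟ r) (ball-unique (size x ℕ.+ r))

  sphere-sound : ∀ {x r z} → z ∈ sphere x r → dist z x ≡ r
  sphere-sound {x} {r} z∈ = proj₂ (∈-filter⁻ (λ z → dist z x ℕ.≟ r) {xs = ballAtRoot k (size x ℕ.+ r)} z∈)

  sphere-complete : ∀ {x r z} → dist z x ≡ r → z ∈ sphere x r
  sphere-complete {x} {r} {z} d≡r = ∈-filter⁺ (λ z → dist z x ℕ.≟ r)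
    (ball-complete _ z (subst (λ d → size z ℕ.≤ size x ℕ.+ d) d≡r (size-≤-dist z x))) d≡r

  sphere-translate : ∀ x r → sphere x r ↭ map (x ⋆_) (layer r)
  sphere-translate x r = ↭-fromMembers (sphere-unique x r) (Unique.map⁺ (⋆-cancelˡ x) (layer-unique r)) to from
    where
    to : ∀ {z} → z ∈ sphere x r → z ∈ map (x ⋆_) (layer r)
    to {z} z∈ = subst (_∈ map (x ⋆_) (layer r)) (⋆-inverseʳ x z)
      (∈-map⁺ (x ⋆_) (subst (λ n → x ⁻¹ ⋆ z ∈ layer n) (trans (dist-as-size z x) (sphere-sound {x} z∈))
        (layer-complete (x ⁻¹ ⋆ z))))
    from : ∀ {z} → z ∈ map (x ⋆_) (layer r) → z ∈ sphere x r
    from z∈ with ∈-map⁻ (x ⋆_) z∈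
    ... | w , w∈ , refl = sphere-complete {x} (trans (dist-translate x w) (layer-sound r w∈))

module Sums {c ℓ} (R : CommutativeRing c ℓ) (inv : ℕ → CommutativeRing.Carrier R) where
  open CommutativeRing R
  open Ops R inv
  open import Relation.Binary.Reasoning.Setoid setoid
  open import Algebra.Properties.CommutativeSemigroup +-commutativeSemigroup using (interchange)

  ΣL : ∀ {A : Set} → List A → (A → Carrier) → Carrier
  ΣL xs f = sumR (map f xs)

  ΣL-↭ : ∀ {A : Set} {xs ys : List A} (f : A → Carrier) → xs ↭ ys → ΣL xs f ≈ ΣL ys f
  ΣL-↭ f xs↭ys = PermSetoid.foldr-commMonoid setoid +-isCommutativeMonoid
    (↭⇒↭ₛ′ isEquivalence (Perm.map⁺ f xs↭ys))

  ΣL-map : ∀ {A B : Set} (g : A → B) (xs : List A) (f : B → Carrier) → ΣL (map g xs) f ≈ ΣL xs (f ∘ g)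
  ΣL-map g xs f = reflexive (≡.cong sumR (≡.sym (LP.map-∘ xs)))

  ΣL-cong : ∀ {A : Set} (xs : List A) {f g : A → Carrier} → (∀ x → f x ≈ g x) → ΣL xs f ≈ ΣL xs g
  ΣL-cong []       f≈g = refl
  ΣL-cong (x ∷ xs) f≈g = +-cong (f≈g x) (ΣL-cong xs f≈g)

  ΣL-cong∈ : ∀ {A : Set} (xs : List A) {f g : A → Carrier} → (∀ {x} → x ∈ xs → f x ≈ g x) → ΣL xs f ≈ ΣL xs g
  ΣL-cong∈ []       f≈g = refl
  ΣL-cong∈ (x ∷ xs) f≈g = +-cong (f≈g (here ≡.refl)) (ΣL-cong∈ xs (f≈g ∘ there))

  ΣL-++ : ∀ {A : Set} (xs ys : List A) (f : A → Carrier) → ΣL (xs ++ ys) f ≈ ΣL xs f + ΣL ys f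
  ΣL-++ []       ys f = sym (+-identityˡ _)
  ΣL-++ (x ∷ xs) ys f = trans (+-congˡ (ΣL-++ xs ys f)) (sym (+-assoc _ _ _))

  ΣL-concatMap : ∀ {A B : Set} (g : A → List B) (xs : List A) (f : B → Carrier) →
    ΣL (concatMap g xs) f ≈ ΣL xs (λ x → ΣL (g x) f)
  ΣL-concatMap g []       f = refl
  ΣL-concatMap g (x ∷ xs) f = trans (ΣL-++ (g x) (concatMap g xs) f) (+-congˡ (ΣL-concatMap g xs f))

  ΣL-+ : ∀ {A : Set} (xs : List A) (f g : A → Carrier) → ΣL xs (λ x → f x + g x) ≈ ΣL xs f + ΣL xs g
  ΣL-+ []       f g = sym (+-identityˡ _)
  ΣL-+ (x ∷ xs) f g = trans (+-congˡ (ΣL-+ xs f g)) (interchange _ _ _ _)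

  ΣL-*ˡ : ∀ {A : Set} (xs : List A) (a : Carrier) (f : A → Carrier) → ΣL xs (λ x → a * f x) ≈ a * ΣL xs f
  ΣL-*ˡ []       a f = sym (zeroʳ a)
  ΣL-*ˡ (x ∷ xs) a f = trans (+-congˡ (ΣL-*ˡ xs a f)) (sym (distribˡ a _ _))

  ΣL-0 : ∀ {A : Set} (xs : List A) → ΣL xs (λ _ → 0#) ≈ 0#
  ΣL-0 []       = refl
  ΣL-0 (x ∷ xs) = trans (+-identityˡ _) (ΣL-0 xs)

  ΣL-swap : ∀ {A B : Set} (xs : List A) (ys : List B) (h : A → B → Carrier) →
    ΣL xs (λ x → ΣL ys (h x)) ≈ ΣL ys (λ y → ΣL xs (λ x → h x y))
  ΣL-swap []       ys h = sym (ΣL-0 ys)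
  ΣL-swap (x ∷ xs) ys h = trans (+-congˡ (ΣL-swap xs ys h)) (sym (ΣL-+ ys (h x) _))

  ι-suc : ∀ n a → ι (suc n) * a ≈ a + ι n * a
  ι-suc n a = trans (distribʳ a 1# (ι n)) (+-congʳ (*-identityˡ a))

  ΣL-const : ∀ {A : Set} (xs : List A) (a : Carrier) → ΣL xs (λ _ → a) ≈ ι (length xs) * a
  ΣL-const []       a = sym (zeroˡ a)
  ΣL-const (x ∷ xs) a = trans (+-congˡ (ΣL-const xs a)) (sym (ι-suc (length xs) a))

  ι-+ : ∀ m n → ι (m ℕ.+ n) ≈ ι m + ι n
  ι-+ zero    n = sym (+-identityˡ _)
  ι-+ (suc m) n = trans (+-congˡ (ι-+ m n)) (sym (+-assoc _ _ _))

  ι-* : ∀ m n → ι (m ℕ.* n) ≈ ι m * ι n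
  ι-* zero    n = sym (zeroˡ _)
  ι-* (suc m) n = begin
    ι (n ℕ.+ m ℕ.* n)   ≈⟨ ι-+ n (m ℕ.* n) ⟩
    ι n + ι (m ℕ.* n)   ≈⟨ +-congˡ (ι-* m n) ⟩
    ι n + ι m * ι n     ≈⟨ ι-suc m (ι n) ⟨
    ι (suc m) * ι n     ∎

  ΣL-allFin-suc : ∀ {n} (h : Fin (suc n) → Carrier) → ΣL (allFin (suc n)) h ≈ h fzero + ΣL (allFin n) (h ∘ fsuc)
  ΣL-allFin-suc h = reflexive (≡.cong (λ hs → h fzero + sumR hs)
    (≡.trans (LP.map-tabulate fsuc h) (≡.sym (LP.map-tabulate (λ i → i) (h ∘ fsuc)))))

  indicator : ∀ {n} → Fin n → Carrier → Fin n → Carrier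
  indicator b a i = if does (i ≟ᶠ b) then a else 0#

  ΣL-indicator : ∀ {n} (b : Fin n) (a : Carrier) → ΣL (allFin n) (indicator b a) ≈ a
  ΣL-indicator {suc n} fzero    a = begin
    ΣL (allFin (suc n)) _          ≈⟨ ΣL-allFin-suc {n} (indicator fzero a) ⟩
    a + ΣL (allFin n) (λ _ → 0#)   ≈⟨ +-congˡ (ΣL-0 (allFin n)) ⟩
    a + 0#                         ≈⟨ +-identityʳ a ⟩
    a                              ∎
  ΣL-indicator {suc n} (fsuc b) a =
    trans (ΣL-allFin-suc {n} (indicator (fsuc b) a)) (trans (+-identityˡ _) (ΣL-indicator b a))

module NeighbourSums {c ℓ} (R : CommutativeRing c ℓ) (inv : ℕ → CommutativeRing.Carrier R) {k : ℕ} where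
  open CommutativeRing R
  open Ops R inv
  open Sums R inv
  open ReducedWords {k}
  open Spheres {k}
  open import Relation.Binary.Reasoning.Setoid setoid
  open import Algebra.Properties.AbelianGroup +-abelianGroup using (∙-cancelʳ)

  -- the generator a as a vertex; the neighbours of y are the vertices letter a ⋆ y
  letter : Fin k → V
  letter a = [ a ] , tt

  neighbourSum : (V → Carrier) → V → Carrier
  neighbourSum G y = ΣL (allFin k) (λ a → G (letter a ⋆ y))

  -- Number of children of a word of length r.
  branch : ℕ → ℕ
  branch zero    = k
  branch (suc _) = k ∸ 1

  ΣL-toVertex : ∀ {w : Word} (F : V → Carrier) → (p : T (noBacktrack w)) → ΣL (toVertex w) F ≈ F (w , p)
  ΣL-toVertex F p = trans (reflexive (≡.cong (λ zs → ΣL zs F) (toVertex-single p))) (+-identityʳ _)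

  ΣL-allFin-const : ∀ C → ΣL (allFin k) (λ _ → C) ≈ ι k * C
  ΣL-allFin-const C = trans (ΣL-const (allFin k) C) (reflexive (≡.cong (λ n → ι n * C) (LP.length-tabulate {n = k} (λ i → i))))

  ΣL-layer-suc : ∀ r F → ΣL (layer (suc r)) F ≈ ΣL (layer r) (λ u → ΣL (children u) F)
  ΣL-layer-suc r F = ΣL-concatMap children (layer r) F

  children-root : ∀ F → ΣL (children root) F ≈ ΣL (allFin k) (F ∘ letter)
  children-root F = trans (ΣL-concatMap (λ a → toVertex [ a ]) (allFin k) F)
                          (ΣL-cong (allFin k) (λ a → ΣL-toVertex F tt))

  neighbourSum-root : ∀ G → neighbourSum G root ≈ ΣL (layer 1) G
  neighbourSum-root G = sym (begin
    ΣL (layer 1) G                  ≈⟨ ΣL-layer-suc 0 G ⟩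
    ΣL (children root) G + 0#       ≈⟨ +-identityʳ _ ⟩
    ΣL (children root) G            ≈⟨ children-root G ⟩
    neighbourSum G root             ∎)

  -- For y = b u reduced, the neighbour b·y is the parent u and the others a·y = a y
  -- are the children of y.
  neighbourSum-split : ∀ G b u y → proj₁ y ≡ b ∷ proj₁ u → neighbourSum G y ≈ ΣL (children y) G + G u
  neighbourSum-split G b (u , q) (.(b ∷ u) , p) ≡.refl = begin
    ΣL (allFin k) (λ a → G (letter a ⋆ y))
      ≈⟨ ΣL-cong (allFin k) (λ a → neighbour a (a ≟ᶠ b)) ⟩
    ΣL (allFin k) (λ a → ΣL (toVertex (a ∷ b ∷ u)) G + indicator b (G (u , q)) a)
      ≈⟨ ΣL-+ (allFin k) _ _ ⟩
    ΣL (allFin k) (λ a → ΣL (toVertex (a ∷ b ∷ u)) G) + ΣL (allFin k) (indicator b (G (u , q)))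
      ≈⟨ +-cong (sym (ΣL-concatMap (λ a → toVertex (a ∷ b ∷ u)) (allFin k) G)) (ΣL-indicator b _) ⟩
    ΣL (children y) G + G (u , q) ∎
    where
    y = (b ∷ u , p)
    neighbour : ∀ a (d : Dec (a ≡ b)) →
      G (letter a ⋆ y) ≈ ΣL (toVertex (a ∷ b ∷ u)) G + (if does d then G (u , q) else 0#)
    neighbour a (yes ≡.refl) = begin
      G (letter a ⋆ y)                  ≡⟨ ≡.cong G (vertex-≡ (push-self a u)) ⟩
      G (u , q)                         ≈⟨ +-identityˡ _ ⟨
      0# + G (u , q)                    ≡⟨ ≡.cong (λ zs → ΣL zs G + G (u , q)) (≡.sym (toVertex-empty {a ∷ a ∷ u} backtrack)) ⟩
      ΣL (toVertex (a ∷ a ∷ u)) G + G (u , q) ∎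
      where backtrack = λ r → head-distinct {a} {a} {u} (mkReduced r) ≡.refl
    neighbour a (no a≢b) = begin
      G (letter a ⋆ y)                  ≡⟨ ≡.cong G (vertex-≡ (push-other {a} {b} u a≢b)) ⟩
      G (a ∷ b ∷ u , r)                 ≈⟨ ΣL-toVertex G r ⟨
      ΣL (toVertex (a ∷ b ∷ u)) G       ≈⟨ +-identityʳ _ ⟨
      ΣL (toVertex (a ∷ b ∷ u)) G + 0#  ∎
      where r = reduced (cons-reduced {a} {b} {u} a≢b (mkReduced p))

  -- A reduced word of length r has branch r children (k at the root, k - 1 elsewhere):
  -- for u = b u′ the k neighbours of u are its parent u′ and its children.
  children-count : ∀ u C → ΣL (children u) (λ _ → C) ≈ ι (branch (size u)) * C
  children-count ([] , tt) C = trans (children-root (λ _ → C)) (ΣL-allFin-const C)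
  children-count (b ∷ u , p) C = ∙-cancelʳ C _ _ (begin
    ΣL (children y) (λ _ → C) + C   ≈⟨ neighbourSum-split (λ _ → C) b (u , q) y ≡.refl ⟨
    ΣL (allFin k) (λ _ → C)         ≈⟨ ΣL-allFin-const C ⟩
    ι k * C                         ≡⟨ ≡.cong (λ n → ι n * C) (n≡1+n∸1 b) ⟩
    ι (suc (k ∸ 1)) * C             ≈⟨ ι-suc (k ∸ 1) C ⟩
    C + ι (k ∸ 1) * C               ≈⟨ +-comm _ _ ⟩
    ι (k ∸ 1) * C + C               ∎)
    where
    y = (b ∷ u , p)
    q = reduced (tail-reduced {b} {u} (mkReduced p))
    n≡1+n∸1 : ∀ {n} → Fin n → n ≡ suc (n ∸ 1)
    n≡1+n∸1 {suc n} _ = ≡.refl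

  -- Σ_{y ∈ layer (r+1)} Σ_{a} G(a·y) counts every word of length r+2 once (through
  -- its parent) and every word of length r once per child of it.
  layer-neighbourSum : ∀ G r →
    ΣL (layer (suc r)) (neighbourSum G) ≈ ΣL (layer (suc (suc r))) G + ι (branch r) * ΣL (layer r) G
  layer-neighbourSum G r = begin
    ΣL (layer (suc r)) (neighbourSum G)
      ≈⟨ ΣL-layer-suc r _ ⟩
    ΣL (layer r) (λ u → ΣL (children u) (neighbourSum G))
      ≈⟨ ΣL-cong (layer r) (λ u → ΣL-cong∈ (children u) (λ {y} y∈ → split u y y∈)) ⟩
    ΣL (layer r) (λ u → ΣL (children u) (λ y → ΣL (children y) G + G u))
      ≈⟨ ΣL-cong (layer r) (λ u → ΣL-+ (children u) _ _) ⟩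
    ΣL (layer r) (λ u → ΣL (children u) (λ y → ΣL (children y) G) + ΣL (children u) (λ _ → G u))
      ≈⟨ ΣL-+ (layer r) _ _ ⟩
    ΣL (layer r) (λ u → ΣL (children u) (λ y → ΣL (children y) G)) + ΣL (layer r) (λ u → ΣL (children u) (λ _ → G u))
      ≈⟨ +-cong grandchildren (ΣL-cong∈ (layer r) (λ {u} u∈ → count u u∈)) ⟩
    ΣL (layer (suc (suc r))) G + ΣL (layer r) (λ u → ι (branch r) * G u)
      ≈⟨ +-congˡ (ΣL-*ˡ (layer r) _ G) ⟩
    ΣL (layer (suc (suc r))) G + ι (branch r) * ΣL (layer r) G ∎
    where
    split : ∀ u y → y ∈ children u → neighbourSum G y ≈ ΣL (children y) G + G u
    split u y y∈ with children-sound {u} y∈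
    ... | b , y≡bu = neighbourSum-split G b u y y≡bu
    grandchildren : ΣL (layer r) (λ u → ΣL (children u) (λ y → ΣL (children y) G)) ≈ ΣL (layer (suc (suc r))) G
    grandchildren = sym (trans (ΣL-layer-suc (suc r) G) (ΣL-layer-suc r _))
    count : ∀ u → u ∈ layer r → ΣL (children u) (λ _ → G u) ≈ ι (branch r) * G u
    count u u∈ = trans (children-count u (G u)) (reflexive (≡.cong (λ n → ι (branch n) * G u) (layer-sound r u∈)))

  sphereTotal : (V → Carrier) → V → ℕ → Carrier
  sphereTotal φ y r = ΣL (sphere y r) φ

  sphereTotal-translate : ∀ φ x r → sphereTotal φ x r ≈ ΣL (layer r) (λ w → φ (x ⋆ w))
  sphereTotal-translate φ x r = trans (ΣL-↭ φ (sphere-translate x r)) (ΣL-map (x ⋆_) (layer r) φ)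

  neighbours-sphereTotal : ∀ φ x r →
    ΣL (sphere x 1) (λ y → sphereTotal φ y r) ≈ ΣL (layer r) (neighbourSum (λ w → φ (x ⋆ w)))
  neighbours-sphereTotal φ x r = begin
    ΣL (sphere x 1) (λ y → sphereTotal φ y r)
      ≈⟨ sphereTotal-translate (λ y → sphereTotal φ y r) x 1 ⟩
    ΣL (layer 1) (λ v → sphereTotal φ (x ⋆ v) r)
      ≈⟨ neighbourSum-root _ ⟨
    ΣL (allFin k) (λ a → sphereTotal φ (x ⋆ letter a) r)
      ≈⟨ ΣL-cong (allFin k) (λ a → sphereTotal-translate φ (x ⋆ letter a) r) ⟩
    ΣL (allFin k) (λ a → ΣL (layer r) (λ w → φ ((x ⋆ letter a) ⋆ w)))
      ≈⟨ ΣL-cong (allFin k) (λ a → ΣL-cong (layer r) (λ w → reflexive (≡.cong φ (⋆-assoc x (letter a) w)))) ⟩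
    ΣL (allFin k) (λ a → ΣL (layer r) (λ w → φ (x ⋆ (letter a ⋆ w))))
      ≈⟨ ΣL-swap (allFin k) (layer r) _ ⟩
    ΣL (layer r) (neighbourSum (λ w → φ (x ⋆ w))) ∎

  neighbours-sphereTotal-zero : ∀ φ x → ΣL (sphere x 1) (λ y → sphereTotal φ y 0) ≈ sphereTotal φ x 1
  neighbours-sphereTotal-zero φ x = begin
    ΣL (sphere x 1) (λ y → sphereTotal φ y 0)          ≈⟨ neighbours-sphereTotal φ x 0 ⟩
    neighbourSum (λ w → φ (x ⋆ w)) root + 0#           ≈⟨ +-identityʳ _ ⟩
    neighbourSum (λ w → φ (x ⋆ w)) root                ≈⟨ neighbourSum-root _ ⟩
    ΣL (layer 1) (λ w → φ (x ⋆ w))                     ≈⟨ sphereTotal-translate φ x 1 ⟨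
    sphereTotal φ x 1                                  ∎

  neighbours-sphereTotal-suc : ∀ φ x r → ΣL (sphere x 1) (λ y → sphereTotal φ y (suc r)) ≈
    sphereTotal φ x (suc (suc r)) + ι (branch r) * sphereTotal φ x r
  neighbours-sphereTotal-suc φ x r = begin
    ΣL (sphere x 1) (λ y → sphereTotal φ y (suc r))    ≈⟨ neighbours-sphereTotal φ x (suc r) ⟩
    ΣL (layer (suc r)) (neighbourSum G)                 ≈⟨ layer-neighbourSum G r ⟩
    ΣL (layer (suc (suc r))) G + ι (branch r) * ΣL (layer r) G
      ≈⟨ +-cong (sphereTotal-translate φ x (suc (suc r))) (*-congˡ (sphereTotal-translate φ x r)) ⟨
    sphereTotal φ x (suc (suc r)) + ι (branch r) * sphereTotal φ x r ∎
    where
    G : V → Carrier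
    G w = φ (x ⋆ w)

module Means {c ℓ} (R : CommutativeRing c ℓ) (inv : ℕ → CommutativeRing.Carrier R)
  (inv-spec : ∀ n → CommutativeRing._≈_ R (CommutativeRing._*_ R (Ops.ι R inv (suc n)) (inv (suc n))) (CommutativeRing.1# R))
  (m : ℕ) where

  k : ℕ
  k = suc (suc m)

  open CommutativeRing R
  open Ops R inv
  open Sums R inv
  open NeighbourSums R inv {k}
  open import Relation.Binary.Reasoning.Setoid setoid
  open import Algebra.Properties.CommutativeSemigroup *-commutativeSemigroup using (interchange; x∙yz≈y∙xz)
  import Algebra.Properties.CommutativeSemigroup ℕP.*-commutativeSemigroup as ℕ*

  inv-cancel : ∀ N .{{_ : NonZero N}} → ι N * inv N ≈ 1#
  inv-cancel (suc n) = inv-spec n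

  inv-scale : ∀ a N M .{{_ : NonZero N}} .{{_ : NonZero M}} → N ≡ a ℕ.* M → ι a * inv N ≈ inv M
  inv-scale a N M N≡aM = begin
    ι a * inv N                       ≈⟨ *-identityʳ _ ⟨
    (ι a * inv N) * 1#                ≈⟨ *-congˡ (inv-cancel M) ⟨
    (ι a * inv N) * (ι M * inv M)     ≈⟨ interchange _ _ _ _ ⟩
    (ι a * ι M) * (inv N * inv M)     ≈⟨ *-congʳ (ι-* a M) ⟨
    ι (a ℕ.* M) * (inv N * inv M)     ≡⟨ ≡.cong (λ n → ι n * (inv N * inv M)) (≡.sym N≡aM) ⟩
    ι N * (inv N * inv M)             ≈⟨ *-assoc _ _ _ ⟨
    (ι N * inv N) * inv M             ≈⟨ *-congʳ (inv-cancel N) ⟩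
    1# * inv M                        ≈⟨ *-identityˡ _ ⟩
    inv M                             ∎

  -- Spheres are non-empty since k ≥ 2, so the normalisation S(r)⁻¹ makes sense.
  S-nonzero : ∀ r → NonZero (S k r)
  S-nonzero zero    = _
  S-nonzero (suc r) = ℕP.m*n≢0 k (suc m ^ r) {{_}} {{ℕP.m^n≢0 (suc m) r}}

  S-step : ∀ r → S k (suc r) ≡ branch r ℕ.* S k r
  S-step zero    = ≡.refl
  S-step (suc r) = ℕ*.x∙yz≈y∙xz k (suc m) (suc m ^ r)

  inv-S-step : ∀ r → ι (branch r) * inv (S k (suc r)) ≈ inv (S k r)
  inv-S-step r = inv-scale (branch r) (S k (suc r)) (S k r) {{S-nonzero (suc r)}} {{S-nonzero r}} (S-step r)

  -- Averaging over the neighbours: Σ_{y∼x} M(y, r) = (k - 1) M(x, r + 1) + M(x, r - 1),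
  -- where M(x, -1) = M(x, 1) by the even extension.
  neighbours-mean : ∀ φ x r →
    ΣL (sphere x 1) (λ y → M φ y (+ r)) ≈ ι (suc m) * M φ x (+ suc r) + M φ x (+ r ℤ.- + 1)
  neighbours-mean φ x zero = begin
    ΣL (sphere x 1) (λ y → inv (S k 0) * sphereTotal φ y 0)  ≈⟨ ΣL-*ˡ (sphere x 1) _ _ ⟩
    inv (S k 0) * ΣL (sphere x 1) (λ y → sphereTotal φ y 0)  ≈⟨ *-congˡ (neighbours-sphereTotal-zero φ x) ⟩
    inv (S k 0) * sphereTotal φ x 1                          ≈⟨ *-congʳ (inv-S-step 0) ⟨
    (ι k * inv (S k 1)) * sphereTotal φ x 1                  ≈⟨ *-assoc _ _ _ ⟩
    ι k * M₁                                                 ≈⟨ ι-suc (suc m) M₁ ⟩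
    M₁ + ι (suc m) * M₁                                      ≈⟨ +-comm _ _ ⟩
    ι (suc m) * M₁ + M₁                                      ∎
    where M₁ = M φ x (+ 1)
  neighbours-mean φ x (suc r) = begin
    ΣL (sphere x 1) (λ y → inv S₁ * sphereTotal φ y (suc r))       ≈⟨ ΣL-*ˡ (sphere x 1) _ _ ⟩
    inv S₁ * ΣL (sphere x 1) (λ y → sphereTotal φ y (suc r))       ≈⟨ *-congˡ (neighbours-sphereTotal-suc φ x r) ⟩
    inv S₁ * (A₂ + ι (branch r) * A₀)                              ≈⟨ distribˡ _ _ _ ⟩
    inv S₁ * A₂ + inv S₁ * (ι (branch r) * A₀)                      ≈⟨ +-congˡ (x∙yz≈y∙xz _ _ _) ⟩
    inv S₁ * A₂ + ι (branch r) * (inv S₁ * A₀)                      ≈⟨ +-cong (*-congʳ (inv-S-step (suc r))) (*-assoc _ _ _) ⟨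
    (ι (suc m) * inv (S k (suc (suc r)))) * A₂ + (ι (branch r) * inv S₁) * A₀
                                                                   ≈⟨ +-cong (*-assoc _ _ _) (*-congʳ (inv-S-step r)) ⟩
    ι (suc m) * M φ x (+ suc (suc r)) + M φ x (+ r)                ∎
    where
    S₁ = S k (suc r)
    A₂ = sphereTotal φ x (suc (suc r))
    A₀ = sphereTotal φ x r

module LaplacianIdentity {c ℓ} (R : CommutativeRing c ℓ) where
  open CommutativeRing R
  open import Algebra.Properties.Ring ring using (x[y-z]≈xy-xz; [y-z]x≈yx-zx)
  open import Algebra.Properties.AbelianGroup +-abelianGroup using (⁻¹-anti-homo‿-; ⁻¹-∙-comm)
  open import Algebra.Solver.CommutativeMonoid +-commutativeMonoid using (solve; _⊜_; _⊕_)
  open import Relation.Binary.Reasoning.Setoid setoid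

  two : Carrier
  two = 1# + (1# + 0#)

  two* : ∀ a → two * a ≈ a + a
  two* a = begin
    (1# + (1# + 0#)) * a   ≈⟨ distribʳ a 1# (1# + 0#) ⟩
    1# * a + (1# + 0#) * a ≈⟨ +-cong (*-identityˡ a) (trans (*-congʳ (+-identityʳ 1#)) (*-identityˡ a)) ⟩
    a + a                  ∎

  cancel : ∀ a b → (a + - a) + b ≈ b
  cancel a b = trans (+-congʳ (-‿inverseʳ a)) (+-identityˡ b)

  laplacian-identity : ∀ e m₀ m₊ m₋ →
    (1# + e) * m₀ - (e * m₊ + m₋) ≈ ((two * m₀ - m₊) - m₋) + (two - (1# + e)) * (m₊ - m₀)
  laplacian-identity e m₀ m₊ m₋ = sym (begin
    ((two * m₀ - m₊) - m₋) + (two - (1# + e)) * (m₊ - m₀)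
      ≈⟨ +-congˡ ([y-z]x≈yx-zx (m₊ - m₀) two (1# + e)) ⟩
    ((two * m₀ - m₊) - m₋) + (two * (m₊ - m₀) - (1# + e) * (m₊ - m₀))
      ≈⟨ +-congˡ (+-cong (x[y-z]≈xy-xz two m₊ m₀) (-‿cong (distribʳ (m₊ - m₀) 1# e))) ⟩
    ((two * m₀ - m₊) - m₋) + ((two * m₊ - two * m₀) - (1# * (m₊ - m₀) + e * (m₊ - m₀)))
      ≈⟨ +-congˡ (+-cong (+-congʳ (two* m₊)) (-‿cong (+-cong (*-identityˡ _) (x[y-z]≈xy-xz e m₊ m₀)))) ⟩
    ((two * m₀ - m₊) - m₋) + (((m₊ + m₊) - two * m₀) - ((m₊ - m₀) + (e * m₊ - e * m₀)))
      ≈⟨ +-congˡ (+-congˡ (trans (sym (⁻¹-∙-comm _ _)) (+-cong (⁻¹-anti-homo‿- m₊ m₀) (⁻¹-anti-homo‿- (e * m₊) (e * m₀))))) ⟩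
    ((two * m₀ - m₊) - m₋) + (((m₊ + m₊) - two * m₀) + ((m₀ - m₊) + (e * m₀ - e * m₊)))
      -- regroup so that each term meets its negative
      ≈⟨ solve 8 (λ T -T P -P -N Z EZ -EP →
           ((T ⊕ -P) ⊕ -N) ⊕ (((P ⊕ P) ⊕ -T) ⊕ ((Z ⊕ -P) ⊕ (EZ ⊕ -EP)))
           ⊜ (T ⊕ -T) ⊕ ((P ⊕ -P) ⊕ ((P ⊕ -P) ⊕ ((Z ⊕ EZ) ⊕ (-EP ⊕ -N))))) refl
           (two * m₀) (- (two * m₀)) m₊ (- m₊) (- m₋) m₀ (e * m₀) (- (e * m₊)) ⟩
    (two * m₀ - two * m₀) + ((m₊ - m₊) + ((m₊ - m₊) + ((m₀ + e * m₀) + (- (e * m₊) - m₋))))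
      ≈⟨ trans (cancel _ _) (trans (cancel _ _) (cancel _ _)) ⟩
    (m₀ + e * m₀) + (- (e * m₊) - m₋)
      ≈⟨ +-cong (sym (trans (distribʳ m₀ 1# e) (+-congʳ (*-identityˡ m₀)))) (⁻¹-∙-comm (e * m₊) m₋) ⟩
    (1# + e) * m₀ - (e * m₊ + m₋) ∎)

theorem4p2 : ∀ {c ℓ} (R : CommutativeRing c ℓ) (inv : ℕ → CommutativeRing.Carrier R) →
  (∀ n → CommutativeRing._≈_ R (CommutativeRing._*_ R (Ops.ι R inv (suc n)) (inv (suc n))) (CommutativeRing.1# R)) →
  (k : ℕ) → 2 ≤ k →
  (φ : Vertex k → CommutativeRing.Carrier R) (x : Vertex k) (r : ℕ) →
  CommutativeRing._≈_ R
    (Ops.ΔT R inv (λ y → Ops.M R inv φ y (+ r)) x)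
    (CommutativeRing._+_ R
      (Ops.ΔP R inv (Ops.M R inv φ x) (+ r))
      (CommutativeRing._*_ R
        (CommutativeRing._-_ R (Ops.ι R inv 2) (Ops.ι R inv k))
        (Ops.∂r R inv (Ops.M R inv φ x) (+ r))))
theorem4p2 R inv inv-spec (suc (suc m)) (s≤s (s≤s z≤n)) φ x r = begin
  ι k * M₀ - ΣL (sphere x 1) (λ y → M φ y (+ r))     ≈⟨ +-congˡ (-‿cong (neighbours-mean φ x r)) ⟩
  ι k * M₀ - (ι (suc m) * M₊ + M₋)                   ≈⟨ laplacian-identity (ι (suc m)) M₀ M₊ M₋ ⟩
  ((ι 2 * M₀ - M₊) - M₋) + (ι 2 - ι k) * (M₊ - M₀)   ≡⟨ ≡.cong (λ n → ((ι 2 * M₀ - M φ x (+ n)) - M₋) + (ι 2 - ι k) * (M φ x (+ n) - M₀))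
                                                         (ℕP.+-comm 1 r) ⟩
  ΔP (M φ x) (+ r) + (ι 2 - ι k) * ∂r (M φ x) (+ r)  ∎
  where
  open CommutativeRing R
  open Ops R inv
  open Sums R inv
  open Means R inv inv-spec m
  open LaplacianIdentity R
  open import Relation.Binary.Reasoning.Setoid setoid
  M₀ = M φ x (+ r)
  M₊ = M φ x (+ suc r)
  M₋ = M φ x (+ r ℤ.- + 1)
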